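{- Let $H=(V,\mathcal{E})$ be a hypergraph and $B$ its simplified Bachman diagram. Each node $X$ of $B$ with $\Phi(X)=\emptyset$ has in-degree at least $2$ in $B$.
   Context: Hyperedges are nonempty and distinct hyperedges may be equal as sets. Let $\mathcal{X}$ be the set of all nonempty sets of the form $\bigcap_{E\in\mathcal{E}'}E$ over nonempty subfamilies $\mathcal{E}'\subseteq\mathcal{E}$ (equal sets counted once). The Bachman diagram $\mathcal{B}(H)$ is the directed graph on node set $\mathcal{X}$ with an arc from $\mathfrak{X}$ to $\mathfrak{Y}$ iff $\mathfrak{X}\supsetneq\mathfrak{Y}$ and there is no $\mathfrak{Z}\in\mathcal{X}$ with $\mathfrak{X}\supsetneq\mathfrak{Z}\supsetneq\mathfrak{Y}$. The label of a node $\mathfrak{X}$ is $\ell(\mathfrak{X})=\mathfrak{X}\setminus\bigcup\{\mathfrak{Y}: (\mathfrak{X},\mathfrak{Y})\text{ an arc}\}$. The simplified Bachman diagram $B$ is the same directed graph with each node $\mathfrak{X}$ replaced by (i.e., carrying) its label $\ell(\mathfrak{X})$. For a hyperedge $E$, $\phi(E)$ is the node of $B$ corresponding to $\mathfrak{X}=E$, and for a node $X$ of $B$, $\Phi(X)=\{E\in\mathcal{E}:\phi(E)=X\}$. -}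

module Defs where

open import Data.Nat using (ℕ)
open import Data.Fin using (Fin)
open import Data.Fin.Subset using (Subset; _∈_; _⊂_; Nonempty)
open import Data.Product using (Σ; _×_; ∃)
open import Function.Bundles using (_⇔_)
open import Relation.Binary.PropositionalEquality using (_≡_; _≢_)
open import Relation.Nullary using (¬_)

-- A finite hypergraph on vertex set Fin n with a family of m hyperedges,
-- indexed by Fin m (so distinct hyperedges may be equal as sets).
-- Hyperedges are nonempty.
record Hypergraph : Set where
  field
    n     : ℕ
    m     : ℕ
    edge  : Fin m → Subset n
    edge-nonempty : ∀ i → Nonempty (edge i)

module _ (H : Hypergraph) where
  open Hypergraph H

  IsIntersectionOf : Subset m → Subset n → Set
  IsIntersectionOf S X = ∀ v → (v ∈ X ⇔ (∀ i → i ∈ S → v ∈ edge i))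

  InX : Subset n → Set
  InX X = Nonempty X × Σ (Subset m) (λ S → Nonempty S × IsIntersectionOf S X)

  Arc : Subset n → Subset n → Set
  Arc X Y = InX X × InX Y × Y ⊂ X × (∀ Z → InX Z → ¬ (Z ⊂ X × Y ⊂ Z))

  -- Φ(X) = ∅ : no hyperedge equals X as a set
  PhiEmpty : Subset n → Set
  PhiEmpty X = ∀ i → edge i ≢ X

  InDegreeAtLeast2 : Subset n → Set
  InDegreeAtLeast2 X = Σ (Subset n) λ Y₁ → Σ (Subset n) λ Y₂ →
    Y₁ ≢ Y₂ × Arc Y₁ X × Arc Y₂ X

-- X is the intersection of a subfamily S, and no hyperedge equals X, so every
-- hyperedge of S lies strictly above X and hence above some node covering X.
-- Take a cover Y₁ below one hyperedge of S and a vertex v ∈ Y₁ ∖ X; as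
-- X = ⋂ S, some hyperedge E of S misses v, and a cover Y₂ below E misses v
-- too, so Y₁ ≢ Y₂.
module Submission where

open import Defs
open import Data.Fin.Subset using (Subset; _∈_; _∉_; _⊆_; _⊂_; ⁅_⁆)
open import Data.Fin.Subset.Properties
  using (_∈?_; _⊂?_; ⊆-trans; ⊆-antisym; anySubset?; nonempty?; x∈⁅x⁆; x∈⁅y⁆⇒x≡y)
open import Data.Fin.Subset.Induction using (⊂-wellFounded)
open import Data.Fin.Properties using (any?; all?)
open import Data.Product using (∃; _×_; _,_; proj₁; uncurry)
open import Function.Base using (id)
open import Function.Bundles using (_⇔_; mk⇔; Equivalence)
open import Induction.WellFounded using (Acc; acc)
open import Level using (0ℓ)
open import Relation.Binary.PropositionalEquality using (_≢_; refl; subst; sym)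
open import Relation.Nullary using (¬_; Dec; yes; no; contradiction)
open import Relation.Nullary.Decidable
  using (_×-dec_; _→-dec_; ¬?; map′; decidable-stable)
open import Relation.Unary using (Pred; Decidable)

open Equivalence using (to; from)

_⇔-dec_ : ∀ {A B : Set} → Dec A → Dec B → Dec (A ⇔ B)
a ⇔-dec b = map′ (uncurry mk⇔) (λ e → to e , from e) ((a →-dec b) ×-dec (b →-dec a))

⊆∧≢⇒⊂ : ∀ {n} {p q : Subset n} → p ⊆ q → q ≢ p → p ⊂ q
⊆∧≢⇒⊂ {p = p} {q} p⊆q q≢p with any? (λ x → (x ∈? q) ×-dec ¬? (x ∈? p))
... | yes (x , x∈q , x∉p) = p⊆q , x , x∈q , x∉p
... | no ∄ = contradiction (⊆-antisym q⊆p p⊆q) q≢p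
  where
    q⊆p : q ⊆ p
    q⊆p x∈q = decidable-stable (_ ∈? p) (λ x∉p → ∄ (_ , x∈q , x∉p))

⊂-minimal-below : ∀ {n} {P : Pred (Subset n) 0ℓ} → Decidable P → ∀ {q} → P q →
                  ∃ λ p → P p × p ⊆ q × (∀ {r} → P r → ¬ r ⊂ p)
⊂-minimal-below {P = P} P? {q} = go (⊂-wellFounded q)
  where
    go : ∀ {q} → Acc _⊂_ q → P q → ∃ λ p → P p × p ⊆ q × (∀ {r} → P r → ¬ r ⊂ p)
    go {q} (acc below) Pq with anySubset? (λ r → P? r ×-dec r ⊂? q)
    ... | yes (r , Pr , r⊂q) with go (below r⊂q) Pr
    ...   | p , Pp , p⊆r , minimal = p , Pp , ⊆-trans p⊆r (proj₁ r⊂q) , minimal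
    go {q} _ Pq | no ∄ = q , Pq , id , λ Pr r⊂q → ∄ (_ , Pr , r⊂q)

module _ (H : Hypergraph) where
  open Hypergraph H

  IsIntersectionOf? : ∀ S X → Dec (IsIntersectionOf H S X)
  IsIntersectionOf? S X =
    all? λ v → (v ∈? X) ⇔-dec all? (λ i → (i ∈? S) →-dec (v ∈? edge i))

  InX? : Decidable (InX H)
  InX? X = nonempty? X ×-dec anySubset? (λ S → nonempty? S ×-dec IsIntersectionOf? S X)

  edge-InX : ∀ i → InX H (edge i)
  edge-InX i = edge-nonempty i , ⁅ i ⁆ , (i , x∈⁅x⁆ i) , λ v →
    mk⇔ (λ v∈Eᵢ j j∈⁅i⁆ → subst (λ k → v ∈ edge k) (sym (x∈⁅y⁆⇒x≡y i j∈⁅i⁆)) v∈Eᵢ)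
        (λ v∈⋂ → v∈⋂ i (x∈⁅x⁆ i))

  intersection-⊆ : ∀ {S X} → IsIntersectionOf H S X → ∀ {i} → i ∈ S → X ⊆ edge i
  intersection-⊆ X≡⋂S i∈S v∈X = to (X≡⋂S _) v∈X _ i∈S

  ∉intersection⇒∃-edge-∌ : ∀ {S X} → IsIntersectionOf H S X → ∀ {v} → v ∉ X →
                           ∃ λ i → i ∈ S × v ∉ edge i
  ∉intersection⇒∃-edge-∌ {S} X≡⋂S {v} v∉X
    with any? (λ i → (i ∈? S) ×-dec ¬? (v ∈? edge i))
  ... | yes witness = witness
  ... | no ∄ = contradiction (from (X≡⋂S v) v∈⋂S) v∉X
    where
      v∈⋂S : ∀ i → i ∈ S → v ∈ edge i
      v∈⋂S i i∈S = decidable-stable (v ∈? edge i) (λ v∉Eᵢ → ∄ (i , i∈S , v∉Eᵢ))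

  arc-below : ∀ {X Z} → InX H X → InX H Z → X ⊂ Z → ∃ λ Y → Arc H Y X × Y ⊆ Z
  arc-below {X} xX xZ X⊂Z with ⊂-minimal-below (λ W → InX? W ×-dec X ⊂? W) (xZ , X⊂Z)
  ... | Y , (xY , X⊂Y) , Y⊆Z , minimal =
    Y , (xY , xX , X⊂Y , λ W xW (W⊂Y , X⊂W) → minimal (xW , X⊂W) W⊂Y) , Y⊆Z

  arc-below-edge : ∀ {S X} → InX H X → IsIntersectionOf H S X → PhiEmpty H X →
                   ∀ {i} → i ∈ S → ∃ λ Y → Arc H Y X × Y ⊆ edge i
  arc-below-edge xX X≡⋂S φ i∈S =
    arc-below xX (edge-InX _) (⊆∧≢⇒⊂ (intersection-⊆ X≡⋂S i∈S) (φ _))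

lemma13 : (H : Hypergraph) → (X : Subset (Hypergraph.n H)) →
    InX H X → PhiEmpty H X → InDegreeAtLeast2 H X
lemma13 H X xX@(_ , S , (i , i∈S) , X≡⋂S) φ
  with arc-below-edge H xX X≡⋂S φ i∈S
... | Y₁ , arc₁@(_ , _ , (_ , v , v∈Y₁ , v∉X) , _) , _
  with ∉intersection⇒∃-edge-∌ H X≡⋂S v∉X
... | j , j∈S , v∉Eⱼ
  with arc-below-edge H xX X≡⋂S φ j∈S
... | Y₂ , arc₂ , Y₂⊆Eⱼ = Y₁ , Y₂ , Y₁≢Y₂ , arc₁ , arc₂
  where
    Y₁≢Y₂ : Y₁ ≢ Y₂
    Y₁≢Y₂ refl = v∉Eⱼ (Y₂⊆Eⱼ v∈Y₁)
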